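{- Let $G$ be a finite simple graph. Then $G\in\mathcal{F}_3$ and $crx_3(G)=3$ if and only if $G$ is isomorphic to $K_3$ or to $K_4$.
   Context: An edge-colouring of $G$ is an arbitrary (not necessarily proper) assignment of colours to the edges of $G$. An edge-coloured cycle is rainbow if all its edges have distinct colours. For $k\geq 1$, $\mathcal{F}_k$ denotes the family of all graphs in which any $k$ vertices lie on a common cycle. For $G\in\mathcal{F}_k$, a $k$-rainbow cycle colouring of $G$ is an edge-colouring such that any $k$ vertices of $G$ lie on a common rainbow cycle of $G$; the $k$-rainbow cycle index $crx_k(G)$ is the minimum number of colours in a $k$-rainbow cycle colouring of $G$ (defined exactly when $G\in\mathcal{F}_k$). -}

module Defs where

open import Data.Nat using (ℕ; zero; suc; _≤_; _+_)
open import Data.Fin using (Fin; zero; suc)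
open import Data.Product using (Σ; ∃; _×_; _,_)
open import Data.Empty using (⊥)
open import Relation.Nullary using (¬_)
open import Relation.Binary.PropositionalEquality using (_≡_)
open import Function.Bundles using (_↔_; Inverse; _⇔_)
open import Function.Definitions using (Injective)

record Graph (n : ℕ) : Set₁ where
  field
    Adj    : Fin n → Fin n → Set
    sym    : ∀ {u v} → Adj u v → Adj v u
    irrefl : ∀ {u} → ¬ Adj u u
open Graph public

K : (m : ℕ) → Graph m
K m = record { Adj = λ u v → ¬ (u ≡ v)
             ; sym = λ p q → p (Relation.Binary.PropositionalEquality.sym q)
             ; irrefl = λ p → p Relation.Binary.PropositionalEquality.refl }

_≅_ : ∀ {n m} → Graph n → Graph m → Set
_≅_ {n} {m} G H =
  Σ (Fin n ↔ Fin m) λ f →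
    ∀ u v → Adj G u v ⇔ Adj H (Inverse.to f u) (Inverse.to f v)

-- Cyclic successor on Fin (suc k): i ↦ i+1 (mod k+1).
csuc : ∀ {k} → Fin (suc k) → Fin (suc k)
csuc {zero} zero = zero
csuc {suc k} zero = suc zero
csuc {suc k} (suc i) with csuc {k} i
... | zero = zero
... | suc j = suc (suc j)

record Cycle {n : ℕ} (G : Graph n) : Set where
  field
    m    : ℕ
    vert : Fin (3 + m) → Fin n
    inj  : Injective _≡_ _≡_ vert
    adj  : ∀ i → Adj G (vert i) (vert (csuc i))
open Cycle public

OnCycle : ∀ {n} {G : Graph n} → Fin n → Cycle G → Set
OnCycle x C = ∃ λ i → vert C i ≡ x

-- An edge-colouring with (at most) c colours: a colour for each (unordered) pair,
-- given symmetrically; only values on edges matter.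
record Colouring (n c : ℕ) : Set where
  field
    col  : Fin n → Fin n → Fin c
    csym : ∀ u v → col u v ≡ col v u
open Colouring public

edgeColour : ∀ {n c} {G : Graph n} → Colouring n c → (C : Cycle G) → Fin (3 + m C) → Fin c
edgeColour χ C i = col χ (vert C i) (vert C (csuc i))

Rainbow : ∀ {n c} {G : Graph n} → Colouring n c → Cycle G → Set
Rainbow χ C = ∀ i j → edgeColour χ C i ≡ edgeColour χ C j → i ≡ j

InF : ∀ {n} → ℕ → Graph n → Set
InF {n} k G = (S : Fin k → Fin n) → Injective _≡_ _≡_ S →
  Σ (Cycle G) λ C → ∀ j → OnCycle (S j) C

IsRainbowCycleColouring : ∀ {n c} → ℕ → (G : Graph n) → Colouring n c → Set
IsRainbowCycleColouring {n} k G χ = (S : Fin k → Fin n) → Injective _≡_ _≡_ S →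
  Σ (Cycle G) λ C → Rainbow χ C × (∀ j → OnCycle (S j) C)

CrxIs : ∀ {n} → ℕ → Graph n → ℕ → Set
CrxIs {n} k G r =
  (Σ (Colouring n r) λ χ → IsRainbowCycleColouring k G χ) ×
  (∀ c (χ : Colouring n c) → IsRainbowCycleColouring k G χ → r ≤ c)

module Submission where

-- A graph lies in F₃ with crx₃ = 3 exactly when it is K₃ or K₄.  Both
-- directions go through *proper* colourings: edges sharing a vertex get
-- distinct colours.
--
-- Forward.  A rainbow cycle has at most as many edges as colours, so under
-- 3 colours it is a triangle.  The rainbow cycle through any three vertices
-- u, v, w thus shows that u v is an edge (G is complete) and that u v, u w
-- are coloured differently (the colouring is proper).  Properness with 3
-- colours bounds the degree by 3, so G has at most 4 vertices; with fewer
-- than 3 vertices one colour would already suffice, contradicting crx₃ = 3.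
--
-- Backward.  In a complete graph any three vertices span a triangle, which
-- is rainbow under a proper colouring; K₄ is properly 3-coloured by its
-- perfect matchings (and K₃ by restriction), and no rainbow cycle can use
-- fewer than 3 colours.

open import Defs hiding (sym)
open import Data.Nat using (ℕ; zero; suc; _≤_; _+_; s≤s; _≤?_)
open import Data.Nat.Properties using (≤-trans; ≤-refl; n≤1+n; m≤m+n)
open import Data.Fin using (Fin; zero; suc; inject≤)
open import Data.Fin.Properties
  using (_≟_; all?; suc-injective; inject≤-injective; injective⇒≤)
open import Data.Product using (Σ; _×_; _,_; proj₁; proj₂)
open import Data.Sum using (_⊎_; inj₁; inj₂)
open import Data.Empty using (⊥-elim)
open import Data.Unit using (tt)
open import Relation.Nullary using (¬_; yes; no)
open import Relation.Nullary.Decidable using (toWitness; decidable-stable; ¬?; _→-dec_)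
open import Relation.Binary.PropositionalEquality
  using (_≡_; _≢_; refl; sym; trans; cong; subst; ≢-sym)
open import Function.Base using (_∘_)
open import Function.Bundles using (_⇔_; Inverse; Injection; Equivalence; mk⇔)
open import Function.Definitions using (Injective)
open import Function.Properties.Inverse using (↔⇒↣)
open import Function.Construct.Identity using (↔-id)
open import Function.Construct.Symmetry using (↔-sym)

Complete : ∀ {n} → Graph n → Set
Complete {n} G = ∀ {u v : Fin n} → u ≢ v → Adj G u v

Proper : ∀ {n c} → Colouring n c → Set
Proper {n} χ = ∀ {u v w : Fin n} → u ≢ v → u ≢ w → v ≢ w → col χ u v ≢ col χ u w

triple : ∀ {n} → Fin n → Fin n → Fin n → Fin 3 → Fin n
triple u v w zero             = u
triple u v w (suc zero)       = v
triple u v w (suc (suc zero)) = w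

triple-injective : ∀ {n} {u v w : Fin n} → u ≢ v → u ≢ w → v ≢ w →
                   Injective _≡_ _≡_ (triple u v w)
triple-injective uv uw vw {zero}             {zero}             _ = refl
triple-injective uv uw vw {zero}             {suc zero}         e = ⊥-elim (uv e)
triple-injective uv uw vw {zero}             {suc (suc zero)}   e = ⊥-elim (uw e)
triple-injective uv uw vw {suc zero}         {zero}             e = ⊥-elim (uv (sym e))
triple-injective uv uw vw {suc zero}         {suc zero}         _ = refl
triple-injective uv uw vw {suc zero}         {suc (suc zero)}   e = ⊥-elim (vw e)
triple-injective uv uw vw {suc (suc zero)}   {zero}             e = ⊥-elim (uw (sym e))
triple-injective uv uw vw {suc (suc zero)}   {suc zero}         e = ⊥-elim (vw (sym e))
triple-injective uv uw vw {suc (suc zero)}   {suc (suc zero)}   _ = refl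

Consecutive : ∀ {L} → Fin (suc L) → Fin (suc L) → Set
Consecutive i j = j ≡ csuc i ⊎ i ≡ csuc j

edgeBetween : ∀ {L} {i j : Fin (suc L)} → Consecutive i j → Fin (suc L)
edgeBetween {i = i} (inj₁ _) = i
edgeBetween {j = j} (inj₂ _) = j

edgeBetween-injective : ∀ {L} {i j l : Fin (suc L)} → i ≢ j → i ≢ l →
  (c : Consecutive i j) (d : Consecutive i l) → edgeBetween c ≡ edgeBetween d → j ≡ l
edgeBetween-injective ij il (inj₁ j≡i⁺) (inj₁ l≡i⁺) _ = trans j≡i⁺ (sym l≡i⁺)
edgeBetween-injective ij il (inj₁ _)    (inj₂ _)    i≡l = ⊥-elim (il i≡l)
edgeBetween-injective ij il (inj₂ _)    (inj₁ _)    j≡i = ⊥-elim (ij (sym j≡i))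
edgeBetween-injective ij il (inj₂ _)    (inj₂ _)    j≡l = j≡l

csuc-no-fixpoint : (i : Fin 3) → i ≢ csuc i
csuc-no-fixpoint zero             ()
csuc-no-fixpoint (suc zero)       ()
csuc-no-fixpoint (suc (suc zero)) ()

csuc²-no-fixpoint : (i : Fin 3) → i ≢ csuc (csuc i)
csuc²-no-fixpoint zero             ()
csuc²-no-fixpoint (suc zero)       ()
csuc²-no-fixpoint (suc (suc zero)) ()

fin3-consecutive : (i j : Fin 3) → i ≢ j → Consecutive i j
fin3-consecutive zero             zero             i≢j = ⊥-elim (i≢j refl)
fin3-consecutive zero             (suc zero)       _   = inj₁ refl
fin3-consecutive zero             (suc (suc zero)) _   = inj₂ refl
fin3-consecutive (suc zero)       zero             _   = inj₂ refl
fin3-consecutive (suc zero)       (suc zero)       i≢j = ⊥-elim (i≢j refl)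
fin3-consecutive (suc zero)       (suc (suc zero)) _   = inj₁ refl
fin3-consecutive (suc (suc zero)) zero             _   = inj₁ refl
fin3-consecutive (suc (suc zero)) (suc zero)       _   = inj₂ refl
fin3-consecutive (suc (suc zero)) (suc (suc zero)) i≢j = ⊥-elim (i≢j refl)

module _ {n : ℕ} {G : Graph n} (C : Cycle G) where

  consecutive-adj : ∀ {i j} → Consecutive i j → Adj G (vert C i) (vert C j)
  consecutive-adj {i} (inj₁ refl) = adj C i
  consecutive-adj {j = j} (inj₂ refl) = Graph.sym G (adj C j)

  consecutive-colour : ∀ {c} (χ : Colouring n c) {i j} (p : Consecutive i j) →
    col χ (vert C i) (vert C j) ≡ edgeColour χ C (edgeBetween p)
  consecutive-colour χ (inj₁ refl) = refl
  consecutive-colour χ {j = j} (inj₂ refl) = csym χ _ (vert C j)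

  rainbow-distinct-at : ∀ {c} (χ : Colouring n c) → Rainbow χ C →
    ∀ {i j l} → i ≢ j → i ≢ l → j ≢ l → Consecutive i j → Consecutive i l →
    col χ (vert C i) (vert C j) ≢ col χ (vert C i) (vert C l)
  rainbow-distinct-at χ rb ij il jl p q e =
    jl (edgeBetween-injective ij il p q
         (rb _ _ (trans (sym (consecutive-colour χ p)) (trans e (consecutive-colour χ q)))))

  rainbow-length : ∀ {c} (χ : Colouring n c) → Rainbow χ C → 3 + m C ≤ c
  rainbow-length χ rb = injective⇒≤ (λ e → rb _ _ e)

-- Under 3 colours every rainbow cycle is a triangle, so all its positions
-- are pairwise consecutive.
rainbow3-consecutive : ∀ {n} {G : Graph n} (χ : Colouring n 3) (C : Cycle G) →
  Rainbow χ C → (i j : Fin (3 + m C)) → i ≢ j → Consecutive i j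
rainbow3-consecutive χ C@record { m = suc _ } rb _ _ _ with rainbow-length C χ rb
... | s≤s (s≤s (s≤s ()))
rainbow3-consecutive χ record { m = zero } _ i j i≢j = fin3-consecutive i j i≢j

module ThreeColours {n : ℕ} {G : Graph n} (χ : Colouring n 3)
                    (rcc : IsRainbowCycleColouring 3 G χ) where

  -- Three distinct vertices lie on a rainbow triangle, whence u v is an edge
  -- and the edges u v, u w are coloured differently.
  rainbow-triangle : ∀ {u v w} → u ≢ v → u ≢ w → v ≢ w →
    Adj G u v × col χ u v ≢ col χ u w
  rainbow-triangle uv uw vw with rcc (triple _ _ _) (triple-injective uv uw vw)
  ... | C , rb , on with on zero | on (suc zero) | on (suc (suc zero))
  ... | i , refl | j , refl | l , refl =
    consecutive-adj C p , rainbow-distinct-at C χ rb ij il jl p q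
    where
    ij : i ≢ j
    ij = uv ∘ cong (vert C)
    il : i ≢ l
    il = uw ∘ cong (vert C)
    jl : j ≢ l
    jl = vw ∘ cong (vert C)
    p : Consecutive i j
    p = rainbow3-consecutive χ C rb i j ij
    q : Consecutive i l
    q = rainbow3-consecutive χ C rb i l il

  proper : Proper χ
  proper uv uw vw = proj₂ (rainbow-triangle uv uw vw)

third : ∀ {k} (u v : Fin (3 + k)) → Σ (Fin (3 + k)) λ w → u ≢ w × v ≢ w
third zero          zero          = suc zero , (λ ()) , (λ ())
third zero          (suc zero)    = suc (suc zero) , (λ ()) , (λ ())
third zero          (suc (suc _)) = suc zero , (λ ()) , (λ ())
third (suc zero)    zero          = suc (suc zero) , (λ ()) , (λ ())
third (suc zero)    (suc zero)    = zero , (λ ()) , (λ ())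
third (suc zero)    (suc (suc _)) = zero , (λ ()) , (λ ())
third (suc (suc _)) zero          = suc zero , (λ ()) , (λ ())
third (suc (suc _)) (suc zero)    = zero , (λ ()) , (λ ())
third (suc (suc _)) (suc (suc _)) = zero , (λ ()) , (λ ())

rcc3⇒complete : ∀ {k} {G : Graph (3 + k)} (χ : Colouring (3 + k) 3) →
  IsRainbowCycleColouring 3 G χ → Complete G
rcc3⇒complete χ rcc {u} {v} u≢v =
  let (w , u≢w , v≢w) = third u v
  in proj₁ (ThreeColours.rainbow-triangle χ rcc u≢v u≢w v≢w)

-- A proper colouring colours the edges at a vertex injectively, so a vertex
-- has at most as many neighbours as there are colours.
proper⇒order≤ : ∀ {n c} (χ : Colouring (suc n) c) → Proper χ → n ≤ c
proper⇒order≤ {n} χ proper = injective⇒≤ colourAt0-injective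
  where
  colourAt0-injective : Injective _≡_ _≡_ (λ (x : Fin n) → col χ zero (suc x))
  colourAt0-injective {x} {y} e with x ≟ y
  ... | yes x≡y = x≡y
  ... | no x≢y  = ⊥-elim (proper (λ ()) (λ ()) (x≢y ∘ suc-injective) e)

few-vertices-rcc : ∀ {n c k} (G : Graph n) (χ : Colouring n c) → ¬ k ≤ n →
  IsRainbowCycleColouring k G χ
few-vertices-rcc G χ k≰n S S-injective = ⊥-elim (k≰n (injective⇒≤ S-injective))

monochromatic : ∀ {n} → Colouring n 1
monochromatic = record { col = λ _ _ → zero ; csym = λ _ _ → refl }

-- crx₃(G) = 3 forces at least 3 vertices: otherwise one colour would do.
crx3⇒3≤order : ∀ {n} (G : Graph n) → CrxIs 3 G 3 → 3 ≤ n
crx3⇒3≤order {n} G (_ , minimal) = decidable-stable (3 ≤? n) λ 3≰n →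
  3≰1 (minimal 1 monochromatic (few-vertices-rcc G monochromatic 3≰n))
  where
  3≰1 : ¬ 3 ≤ 1
  3≰1 (s≤s ())

complete⇒≅K : ∀ {n} (G : Graph n) → Complete G → G ≅ K n
complete⇒≅K G complete = ↔-id _ , λ u v → mk⇔ (adj⇒distinct u v) complete
  where
  adj⇒distinct : ∀ u v → Adj G u v → u ≢ v
  adj⇒distinct u v a u≡v = irrefl G (subst (Adj G u) (sym u≡v) a)

forward : ∀ {n} (G : Graph n) → InF 3 G × CrxIs 3 G 3 → G ≅ K 3 ⊎ G ≅ K 4
forward G (_ , crx@((χ , rcc) , _)) = classify G χ rcc (crx3⇒3≤order G crx)
  where
  -- Between 3 and 4 vertices G is complete; 5 or more would make the
  -- proper 3-colouring give one vertex 4 distinctly coloured edges.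
  classify : ∀ {n} (G : Graph n) (χ : Colouring n 3) → IsRainbowCycleColouring 3 G χ →
    3 ≤ n → G ≅ K 3 ⊎ G ≅ K 4
  classify {1} _ _ _ (s≤s ())
  classify {2} _ _ _ (s≤s (s≤s ()))
  classify {3} G χ rcc _ = inj₁ (complete⇒≅K G (rcc3⇒complete χ rcc))
  classify {4} G χ rcc _ = inj₂ (complete⇒≅K G (rcc3⇒complete χ rcc))
  classify {suc (suc (suc (suc (suc _))))} G χ rcc _
    with proper⇒order≤ χ (ThreeColours.proper χ rcc)
  ... | s≤s (s≤s (s≤s ()))

module CompleteGraph {n : ℕ} {G : Graph n} (complete : Complete G) where

  triangle : (S : Fin 3 → Fin n) → Injective _≡_ _≡_ S → Cycle G
  triangle S S-injective = record
    { m = 0 ; vert = S ; inj = S-injective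
    ; adj = λ i → complete (csuc-no-fixpoint i ∘ S-injective) }

  proper⇒edges-at : ∀ {c} (χ : Colouring n c) → Proper χ →
    (S : Fin 3 → Fin n) → Injective _≡_ _≡_ S →
    ∀ i → col χ (S (csuc i)) (S i) ≢ col χ (S (csuc i)) (S (csuc (csuc i)))
  proper⇒edges-at χ proper S S-injective i =
    proper (≢-sym (csuc-no-fixpoint i) ∘ S-injective)
           (csuc-no-fixpoint (csuc i) ∘ S-injective)
           (csuc²-no-fixpoint i ∘ S-injective)

  -- A triangle is rainbow under a proper colouring: any two of its edges
  -- are consecutive, so share a vertex.
  proper⇒triangle-rainbow : ∀ {c} (χ : Colouring n c) → Proper χ →
    (S : Fin 3 → Fin n) (S-injective : Injective _≡_ _≡_ S) →
    Rainbow χ (triangle S S-injective)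
  proper⇒triangle-rainbow χ proper S S-injective i j e with i ≟ j
  ... | yes i≡j = i≡j
  ... | no i≢j with fin3-consecutive i j i≢j
  ...   | inj₁ refl =
    ⊥-elim (proper⇒edges-at χ proper S S-injective i (trans (csym χ _ _) e))
  ...   | inj₂ refl =
    ⊥-elim (proper⇒edges-at χ proper S S-injective j (trans (csym χ _ _) (sym e)))

  proper⇒rcc : ∀ {c} (χ : Colouring n c) → Proper χ → IsRainbowCycleColouring 3 G χ
  proper⇒rcc χ proper S S-injective =
    triangle S S-injective , proper⇒triangle-rainbow χ proper S S-injective , λ j → j , refl

  inF3 : InF 3 G
  inF3 S S-injective = triangle S S-injective , λ j → j , refl

rcc⇒3≤colours : ∀ {n c k} {G : Graph n} (χ : Colouring n c) → k ≤ n →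
  IsRainbowCycleColouring k G χ → 3 ≤ c
rcc⇒3≤colours χ k≤n rcc
  with rcc (λ i → inject≤ i k≤n) (inject≤-injective k≤n k≤n _ _)
... | C , rb , _ = ≤-trans (m≤m+n 3 (m C)) (rainbow-length C χ rb)

complete-proper⇒crx3 : ∀ {n} {G : Graph n} → Complete G →
  (χ : Colouring n 3) → Proper χ → 3 ≤ n → InF 3 G × CrxIs 3 G 3
complete-proper⇒crx3 complete χ proper 3≤n =
  inF3 , (χ , proper⇒rcc χ proper) , λ c ψ rcc → rcc⇒3≤colours ψ 3≤n rcc
  where open CompleteGraph complete

-- The proper 3-colouring of K₄ by its perfect matchings
-- {01, 23}, {02, 13}, {03, 12}; loops are irrelevant.
matching : Fin 4 → Fin 4 → Fin 3
matching zero                   (suc zero)             = zero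
matching (suc zero)             zero                   = zero
matching (suc (suc zero))       (suc (suc (suc zero))) = zero
matching (suc (suc (suc zero))) (suc (suc zero))       = zero
matching zero                   (suc (suc zero))       = suc zero
matching (suc (suc zero))       zero                   = suc zero
matching (suc zero)             (suc (suc (suc zero))) = suc zero
matching (suc (suc (suc zero))) (suc zero)             = suc zero
matching _                      _                      = suc (suc zero)

matching-sym : ∀ u v → matching u v ≡ matching v u
matching-sym = toWitness {a? = all? λ u → all? λ v → matching u v ≟ matching v u} tt

matching-proper : ∀ u v w → u ≢ v → u ≢ w → v ≢ w → matching u v ≢ matching u w
matching-proper = toWitness {a? = all? λ u → all? λ v → all? λ w →
  ¬? (u ≟ v) →-dec ¬? (u ≟ w) →-dec ¬? (v ≟ w) →-dec ¬? (matching u v ≟ matching u w)} tt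

matchingVia : ∀ {n} → (Fin n → Fin 4) → Colouring n 3
matchingVia e = record { col = λ u v → matching (e u) (e v) ; csym = λ u v → matching-sym (e u) (e v) }

matchingVia-proper : ∀ {n} (e : Fin n → Fin 4) → Injective _≡_ _≡_ e → Proper (matchingVia e)
matchingVia-proper e e-injective uv uw vw =
  matching-proper _ _ _ (uv ∘ e-injective) (uw ∘ e-injective) (vw ∘ e-injective)

≅K⇒complete : ∀ {n m} (G : Graph n) → G ≅ K m → Complete G
≅K⇒complete G (f , adj⇔) {u} {v} u≢v =
  Equivalence.from (adj⇔ u v) (u≢v ∘ Injection.injective (↔⇒↣ f))

≅K⇒crx3 : ∀ {n m} (G : Graph n) → G ≅ K m → 3 ≤ m → m ≤ 4 → InF 3 G × CrxIs 3 G 3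
≅K⇒crx3 {n} {m} G iso@(f , _) 3≤m m≤4 =
  complete-proper⇒crx3 (≅K⇒complete G iso) (matchingVia embed)
    (matchingVia-proper embed embed-injective) (≤-trans 3≤m m≤n)
  where
  embed : Fin n → Fin 4
  embed u = inject≤ (Inverse.to f u) m≤4
  embed-injective : Injective _≡_ _≡_ embed
  embed-injective = Injection.injective (↔⇒↣ f) ∘ inject≤-injective m≤4 m≤4 _ _
  m≤n : m ≤ n
  m≤n = injective⇒≤ (Injection.injective (↔⇒↣ (↔-sym f)))

backward : ∀ {n} (G : Graph n) → G ≅ K 3 ⊎ G ≅ K 4 → InF 3 G × CrxIs 3 G 3
backward G (inj₁ iso) = ≅K⇒crx3 G iso ≤-refl (n≤1+n 3)
backward G (inj₂ iso) = ≅K⇒crx3 G iso (n≤1+n 3) ≤-refl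

theorem6 : ∀ {n : ℕ} (G : Graph n) →
    (InF 3 G × CrxIs 3 G 3) ⇔ (G ≅ K 3 ⊎ G ≅ K 4)
theorem6 G = mk⇔ (forward G) (backward G)
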